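{- Let $k,n$ be positive integers with $k\le n/200$, and let $m=36\cdot 2^k\ln n$. Draw $(g,\mathcal{D})$ from the distribution NO defined as follows: choose independently a uniformly random $J\subseteq[n]$ with $|J|=k$ and a uniformly random $S\subseteq\{0,1\}^n$ with $|S|=m$; draw $h$ uniformly among all functions depending only on the coordinates in $J$ (i.e. an independent uniform bit $b(z)$ for each $z\in\{0,1\}^J$ and $h(x)=b(x_J)$); draw $\gamma:S\to\{0,1\}$ uniformly at random; let $\mathcal{D}$ be the uniform distribution on $S$; and define $g$ by $g(y)=\gamma(y)$ for $y\in S$, and for $x\notin S$: if no $y\in S$ satisfies $y_J=x_J$ and $d(x,y)\le 0.4n$, set $g(x)=h(x)$; otherwise set $g(x)=1$ if some such $y$ has $\gamma(y)=1$, and $g(x)=0$ if every such $y$ has $\gamma(y)=0$. Then with probability at least $1-o_k(1)$, $g$ is $1/3$-far from every $k$-junta with respect to $\mathcal{D}$.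
   Context: $x_J$ is the projection of $x$ onto coordinates in $J$; $d(x,y)$ is Hamming distance. A $k$-junta is a Boolean function on $\{0,1\}^n$ depending on at most $k$ variables; $g$ is $1/3$-far from every $k$-junta with respect to $\mathcal{D}$ if $\Pr_{x\sim\mathcal{D}}[g(x)\ne f(x)]\ge 1/3$ for every $k$-junta $f$. $o_k(1)$ denotes a quantity tending to $0$ as $k\to\infty$. -}

module Defs where

open import Data.Bool using (Bool; true; false; if_then_else_; _∧_; _∨_; not; _xor_)
open import Data.Nat using (ℕ; zero; suc; _+_; _*_; _∸_; _^_; _≤_; _<_; _≤ᵇ_)
open import Data.Nat.Combinatorics using (_C_)
open import Data.List using (List; []; _∷_; _++_; map; length)
open import Data.Vec using (Vec; []; _∷_; lookup)
open import Data.Fin using (Fin)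
open import Data.Product using (_×_; _,_; ∃-syntax)
open import Relation.Binary.PropositionalEquality using (_≡_)

-- Boolean functions {0,1}^n → {0,1}, represented first-order as complete
-- binary trees of depth n (so _≡_ on them is extensional equality).
BFun : ℕ → Set
BFun zero = Bool
BFun (suc n) = BFun n × BFun n

app : ∀ {n} → BFun n → Vec Bool n → Bool
app {zero} b [] = b
app {suc n} (f0 , f1) (false ∷ xs) = app f0 xs
app {suc n} (f0 , f1) (true ∷ xs) = app f1 xs

-- application to a list of bits (x_J); only used with lists of length k
appL : ∀ {k} → BFun k → List Bool → Bool
appL {zero} b _ = b
appL {suc k} (f0 , f1) [] = app f0 (falses k)
  where
  falses : (j : ℕ) → Vec Bool j
  falses zero = []
  falses (suc j) = false ∷ falses j
appL {suc k} (f0 , f1) (false ∷ xs) = appL f0 xs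
appL {suc k} (f0 , f1) (true ∷ xs) = appL f1 xs

cube : (n : ℕ) → List (Vec Bool n)
cube zero = [] ∷ []
cube (suc n) = map (false ∷_) (cube n) ++ map (true ∷_) (cube n)

countᵇ : ∀ {A : Set} → (A → Bool) → List A → ℕ
countᵇ p [] = 0
countᵇ p (x ∷ xs) = if p x then suc (countᵇ p xs) else countᵇ p xs

anyᵇ : ∀ {A : Set} → (A → Bool) → List A → Bool
anyᵇ p [] = false
anyᵇ p (x ∷ xs) = p x ∨ anyᵇ p xs

-- number of true entries of a vector (|J| for J ⊆ [n] as a characteristic vector)
weight : ∀ {n} → Vec Bool n → ℕ
weight [] = 0
weight (true ∷ v) = suc (weight v)
weight (false ∷ v) = weight v

-- |S| for S ⊆ {0,1}^n given by its indicator
size : ∀ {n} → BFun n → ℕ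
size {n} S = countᵇ (app S) (cube n)

ham : ∀ {n} → Vec Bool n → Vec Bool n → ℕ
ham [] [] = 0
ham (a ∷ x) (b ∷ y) = (if a xor b then 1 else 0) + ham x y

proj : ∀ {n} → Vec Bool n → Vec Bool n → List Bool
proj [] [] = []
proj (true ∷ J) (a ∷ x) = a ∷ proj J x
proj (false ∷ J) (a ∷ x) = proj J x

eqB : Bool → Bool → Bool
eqB a b = not (a xor b)

eqL : List Bool → List Bool → Bool
eqL [] [] = true
eqL (a ∷ x) (b ∷ y) = eqB a b ∧ eqL x y
eqL _ _ = false

gNO : ∀ {n k} → Vec Bool n → BFun n → BFun k → BFun n → Vec Bool n → Bool
gNO {n} J S b γ x =
  if app S x then app γ x
  else (if anyᵇ (λ y → true) W then anyᵇ (app γ) W else appL b (proj J x))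
  where
  near : Vec Bool n → Bool
  near y = app S y ∧ (eqL (proj J y) (proj J x) ∧ ((5 * ham x y) ≤ᵇ (2 * n)))
  W : List (Vec Bool n)
  W = Data.List.filterᵇ near (cube n)

IsJunta : (n k : ℕ) → (Vec Bool n → Bool) → Set
IsJunta n k f = ∃[ K ] (weight K ≤ k ×
  (∀ (x y : Vec Bool n) → (∀ (i : Fin n) → lookup K i ≡ true → lookup x i ≡ lookup y i) → f x ≡ f y))

-- g is 1/3-far from every k-junta w.r.t. the uniform distribution on S (|S| = m):
-- #{y ∈ S : g y ≠ f y} / m ≥ 1/3
FarFromJuntas : (n k m : ℕ) → BFun n → (Vec Bool n → Bool) → Set
FarFromJuntas n k m S g = ∀ (f : Vec Bool n → Bool) → IsJunta n k f →
  m ≤ 3 * countᵇ (λ y → app S y ∧ not (eqB (g y) (f y))) (cube n)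

-- outcomes (J, S, b, γ); γ : S → {0,1} is stored as a function on the cube
-- that vanishes outside S (bijective with functions S → {0,1}).
Outcome : ℕ → ℕ → Set
Outcome n k = Vec Bool n × BFun n × BFun k × BFun n

Valid : (n k m : ℕ) → Outcome n k → Set
Valid n k m (J , S , b , γ) = weight J ≡ k × size S ≡ m ×
  (∀ (x : Vec Bool n) → app γ x ≡ true → app S x ≡ true)

Good : (n k m : ℕ) → Outcome n k → Set
Good n k m ω@(J , S , b , γ) = Valid n k m ω × FarFromJuntas n k m S (gNO J S b γ)

-- number of (equally likely) valid outcomes
total : (n k m : ℕ) → ℕ
total n k m = (n C k) * ((2 ^ n) C m) * (2 ^ (2 ^ k)) * (2 ^ m)

-- m = ⌈ c · ln n ⌉, characterised in ℕ via (1 - y/N)^(-N) ↓ e^y: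
--   c ln n ≤ m      ⇔ ∀ N > m/c, n · (Nc - m)^N ≤ (Nc)^N
--   m - 1 < c ln n  ⇔ ∃ N > (m-1)/c, (Nc)^N < n · (Nc - (m-1))^N
IsCeilMulLn : (c n m : ℕ) → Set
IsCeilMulLn c n m =
  (∀ (N : ℕ) → m < N * c → n * (N * c ∸ m) ^ N ≤ (N * c) ^ N) ×
  (1 ≤ m → ∃[ N ] (m ∸ 1 < N * c × (N * c) ^ N < n * (N * c ∸ (m ∸ 1)) ^ N))

{-# OPTIONS --safe #-}
-- On S the function g is just the labelling γ, so only the pair (S, γ) matters.
-- Fix S with |S| = m and a k-junta f.  The binomial identity
-- Σ_{γ ⊆ S} 2^{#agreements of γ and f on S} = 3^m and Markov's inequality show
-- that at most 3^m / 2^{⌈2m/3⌉} of the 2^m labellings are 1/3-close to f.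
-- A k-junta is given by at most k relevant coordinates and a truth table, so there
-- are at most (n+1)^k · 2^{2^k} of them, and by the union bound all but a fraction
-- 1/d of the labellings are far from every junta once
-- (d (n+1)^k 2^{2^k})^3 (27/32)^m ≤ 1.  For k ≥ d³ + 6 this follows from
-- n^{2·2^k} ≤ (18/17)^m, which is m ≥ 36 · 2^k ln n combined with Bernoulli's inequality.
module Submission where

open import Defs
open import Data.Bool using (Bool; true; false; T; _∧_; _∨_; not)
open import Data.Bool.Properties using (T-∨; T-not-≡; not-involutive)
open import Data.Empty using (⊥; ⊥-elim)
open import Data.Fin using (Fin; zero; suc)
open import Data.List using (List; []; _∷_; _++_; map; length; filterᵇ)
open import Data.List.Properties using (length-++; length-map; map-++; map-∘; map-cong)
open import Data.List.Membership.Propositional using (_∈_)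
open import Data.List.Membership.Propositional.Properties
  using (∈-map⁻; ∈-map⁺; ∈-++⁻; ∈-++⁺ˡ; ∈-++⁺ʳ)
open import Data.List.Relation.Unary.Any using (here; there)
open import Data.List.Relation.Unary.All as All using (All; []; _∷_)
import Data.List.Relation.Unary.All.Properties as All
open import Data.List.Relation.Unary.Unique.Propositional using (Unique; []; _∷_)
import Data.List.Relation.Unary.Unique.Propositional.Properties as Unique
open import Data.Nat
open import Data.Nat.Properties
open import Algebra.Properties.CommutativeSemigroup *-commutativeSemigroup
  using (x∙yz≈y∙xz; xy∙z≈y∙xz; xy∙z≈xz∙y)
open import Data.Nat.Combinatorics using (_C_; nCk+nC[k+1]≡[n+1]C[k+1])
open import Data.Nat.DivMod using (m*n/n≡m; /-monoˡ-≤; m/n*n≤m)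
open import Data.Nat.ListAction using (sum)
open import Data.Nat.ListAction.Properties using (sum-++)
open import Data.Nat.Tactic.RingSolver using (solve-∀)
open import Data.Product using (_×_; _,_; proj₁; proj₂; ∃-syntax)
open import Data.Sum using (inj₁; inj₂)
open import Data.Vec using (Vec; []; _∷_; lookup)
import Data.Vec as Vec
open import Data.Vec.Properties using (∷-injectiveʳ; take++drop≡id)
open import Function using (_∘_; Equivalence)
open import Relation.Binary.PropositionalEquality
open import Relation.Nullary using (yes; no)
open import Relation.Nullary.Decidable using (T?)

private variable
  A B I : Set

-- Finite products and counting

dependentProduct : List A → (A → List B) → List (A × B)
dependentProduct []       f = []
dependentProduct (a ∷ as) f = map (a ,_) (f a) ++ dependentProduct as f

∈-dependentProduct⁻ : ∀ as (f : A → List B) {p} → p ∈ dependentProduct as f → proj₁ p ∈ as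
∈-dependentProduct⁻ (a ∷ as) f p∈ with ∈-++⁻ (map (a ,_) (f a)) p∈
... | inj₁ p∈map with ∈-map⁻ (a ,_) p∈map
...   | _ , _ , refl = here refl
∈-dependentProduct⁻ (a ∷ as) f p∈ | inj₂ p∈rest = there (∈-dependentProduct⁻ as f p∈rest)

∈-dependentProduct⁺ : ∀ {as} {f : A → List B} {a b} →
  a ∈ as → b ∈ f a → (a , b) ∈ dependentProduct as f
∈-dependentProduct⁺ {as = a ∷ as} {f} (here refl) b∈ = ∈-++⁺ˡ (∈-map⁺ (a ,_) b∈)
∈-dependentProduct⁺ {as = a ∷ as} {f} (there a∈) b∈ =
  ∈-++⁺ʳ (map (a ,_) (f a)) (∈-dependentProduct⁺ a∈ b∈)

unique-dependentProduct : ∀ {as} {f : A → List B} →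
  Unique as → (∀ a → Unique (f a)) → Unique (dependentProduct as f)
unique-dependentProduct {as = []} _ _ = []
unique-dependentProduct {as = a ∷ as} {f} (a∉as ∷ as!) f! =
  Unique.++⁺ (Unique.map⁺ (cong proj₂) (f! a)) (unique-dependentProduct as! f!) disjoint
  where
  disjoint : ∀ {p} → p ∈ map (a ,_) (f a) × p ∈ dependentProduct as f → ⊥
  disjoint (p∈map , p∈rest) with ∈-map⁻ (a ,_) p∈map
  ... | _ , _ , refl = All.lookup a∉as (∈-dependentProduct⁻ as f p∈rest) refl

all-dependentProduct : ∀ {P : A × B → Set} {f : A → List B} as →
  All (λ a → All (λ b → P (a , b)) (f a)) as → All P (dependentProduct as f)
all-dependentProduct []       []         = []
all-dependentProduct (a ∷ as) (Pa ∷ Pas) = All.++⁺ (All.map⁺ Pa) (all-dependentProduct as Pas)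

length-dependentProduct-≥ : ∀ {f : A → List B} {c d} as →
  All (λ a → c ≤ length (f a) * d) as → length as * c ≤ length (dependentProduct as f) * d
length-dependentProduct-≥             []       []            = z≤n
length-dependentProduct-≥ {f = f} {c} {d} (a ∷ as) (c≤fa ∷ c≤fas) = begin
  c + length as * c
    ≤⟨ +-mono-≤ c≤fa (length-dependentProduct-≥ as c≤fas) ⟩
  length (f a) * d + length (dependentProduct as f) * d
    ≡⟨ *-distribʳ-+ d (length (f a)) _ ⟨
  (length (f a) + length (dependentProduct as f)) * d
    ≡⟨ cong (_* d) length-∷ ⟨
  length (dependentProduct (a ∷ as) f) * d ∎
  where
  open ≤-Reasoning
  length-∷ : length (dependentProduct (a ∷ as) f) ≡ length (f a) + length (dependentProduct as f)
  length-∷ = trans (length-++ (map (a ,_) (f a))) (cong (_+ _) (length-map (a ,_) (f a)))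

length-map-++-map : ∀ (f g : A → B) xs ys → length (map f xs ++ map g ys) ≡ length xs + length ys
length-map-++-map f g xs ys = trans (length-++ (map f xs)) (cong₂ _+_ (length-map f xs) (length-map g ys))

sum-map-*ˡ : ∀ c (w : A → ℕ) xs → sum (map (λ x → c * w x) xs) ≡ c * sum (map w xs)
sum-map-*ˡ c w []       = sym (*-zeroʳ c)
sum-map-*ˡ c w (x ∷ xs) = trans (cong (c * w x +_) (sum-map-*ˡ c w xs)) (sym (*-distribˡ-+ c (w x) _))

sum-dependentProduct : ∀ (u : A → ℕ) (v : B → ℕ) as bs →
  sum (map (λ p → u (proj₁ p) * v (proj₂ p)) (dependentProduct as (λ _ → bs))) ≡ sum (map u as) * sum (map v bs)
sum-dependentProduct u v []       bs = refl
sum-dependentProduct u v (a ∷ as) bs = begin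
  sum (map w (map (a ,_) bs ++ dependentProduct as (λ _ → bs)))
    ≡⟨ cong sum (map-++ w (map (a ,_) bs) _) ⟩
  sum (map w (map (a ,_) bs) ++ map w (dependentProduct as (λ _ → bs)))
    ≡⟨ sum-++ (map w (map (a ,_) bs)) _ ⟩
  sum (map w (map (a ,_) bs)) + sum (map w (dependentProduct as (λ _ → bs)))
    ≡⟨ cong₂ _+_ (trans (cong sum (sym (map-∘ bs))) (sum-map-*ˡ (u a) v bs)) (sum-dependentProduct u v as bs) ⟩
  u a * sum (map v bs) + sum (map u as) * sum (map v bs)
    ≡⟨ *-distribʳ-+ (sum (map v bs)) (u a) _ ⟨
  (u a + sum (map u as)) * sum (map v bs) ∎
  where
  open ≡-Reasoning
  w : _ → ℕ
  w p = u (proj₁ p) * v (proj₂ p)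

countᵇ-++ : ∀ (p : A → Bool) xs ys → countᵇ p (xs ++ ys) ≡ countᵇ p xs + countᵇ p ys
countᵇ-++ p []       ys = refl
countᵇ-++ p (x ∷ xs) ys with p x
... | true  = cong suc (countᵇ-++ p xs ys)
... | false = countᵇ-++ p xs ys

countᵇ-map : ∀ (p : B → Bool) (g : A → B) xs → countᵇ p (map g xs) ≡ countᵇ (p ∘ g) xs
countᵇ-map p g []       = refl
countᵇ-map p g (x ∷ xs) with p (g x)
... | true  = cong suc (countᵇ-map p g xs)
... | false = countᵇ-map p g xs

countᵇ-cong : ∀ {p q : A → Bool} xs → (∀ x → p x ≡ q x) → countᵇ p xs ≡ countᵇ q xs
countᵇ-cong {q = q} []       p≗q = refl
countᵇ-cong {q = q} (x ∷ xs) p≗q rewrite p≗q x with q x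
... | true  = cong suc (countᵇ-cong xs p≗q)
... | false = countᵇ-cong xs p≗q

countᵇ-∧-not : ∀ (p q : A → Bool) xs →
  countᵇ (λ x → p x ∧ q x) xs + countᵇ (λ x → p x ∧ not (q x)) xs ≡ countᵇ p xs
countᵇ-∧-not p q []       = refl
countᵇ-∧-not p q (x ∷ xs) with p x | q x
... | true  | true  = cong suc (countᵇ-∧-not p q xs)
... | true  | false = trans (+-suc _ _) (cong suc (countᵇ-∧-not p q xs))
... | false | _     = countᵇ-∧-not p q xs

countᵇ-true : ∀ (xs : List A) → countᵇ (λ _ → true) xs ≡ length xs
countᵇ-true []       = refl
countᵇ-true (x ∷ xs) = cong suc (countᵇ-true xs)

length-filterᵇ : ∀ (p : A → Bool) xs → length (filterᵇ p xs) ≡ countᵇ p xs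
length-filterᵇ p []       = refl
length-filterᵇ p (x ∷ xs) with p x
... | true  = cong suc (length-filterᵇ p xs)
... | false = length-filterᵇ p xs

countᵇ-∨ : ∀ (p q : A → Bool) xs → countᵇ (λ x → p x ∨ q x) xs ≤ countᵇ p xs + countᵇ q xs
countᵇ-∨ p q []       = z≤n
countᵇ-∨ p q (x ∷ xs) with p x | q x
... | true  | true  = s≤s (≤-trans (countᵇ-∨ p q xs) (+-monoʳ-≤ (countᵇ p xs) (n≤1+n _)))
... | true  | false = s≤s (countᵇ-∨ p q xs)
... | false | true  = ≤-trans (s≤s (countᵇ-∨ p q xs)) (≤-reflexive (sym (+-suc _ _)))
... | false | false = countᵇ-∨ p q xs

countᵇ-markov : ∀ {p : A → Bool} {X} (w : A → ℕ) xs → (∀ x → T (p x) → X ≤ w x) →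
  countᵇ p xs * X ≤ sum (map w xs)
countᵇ-markov w []       X≤w = z≤n
countᵇ-markov {p = p} w (x ∷ xs) X≤w with p x in px
... | true  = +-mono-≤ (X≤w x (subst T (sym px) _)) (countᵇ-markov w xs X≤w)
... | false = ≤-trans (countᵇ-markov w xs X≤w) (m≤n+m _ (w x))

countᵇ-union-bound : ∀ (q : I → A → Bool) {X Y} is xs → (∀ i → countᵇ (q i) xs * X ≤ Y) →
  countᵇ (λ x → anyᵇ (λ i → q i x) is) xs * X ≤ length is * Y
countᵇ-union-bound q []       xs _ = ≤-reflexive (cong (_* _) (countᵇ-false xs))
  where
  countᵇ-false : ∀ (xs : List A) → countᵇ (λ _ → false) xs ≡ 0
  countᵇ-false []       = refl
  countᵇ-false (_ ∷ xs) = countᵇ-false xs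
countᵇ-union-bound q {X} {Y} (i ∷ is) xs bound = begin
  countᵇ (λ x → q i x ∨ anyᵇ (λ i → q i x) is) xs * X
    ≤⟨ *-monoˡ-≤ X (countᵇ-∨ (q i) _ xs) ⟩
  (countᵇ (q i) xs + countᵇ (λ x → anyᵇ (λ i → q i x) is) xs) * X
    ≡⟨ *-distribʳ-+ X (countᵇ (q i) xs) _ ⟩
  countᵇ (q i) xs * X + countᵇ (λ x → anyᵇ (λ i → q i x) is) xs * X
    ≤⟨ +-mono-≤ (bound i) (countᵇ-union-bound q is xs bound) ⟩
  Y + length is * Y ∎
  where open ≤-Reasoning

anyᵇ-∈ : ∀ (p : A → Bool) {x xs} → x ∈ xs → T (p x) → T (anyᵇ p xs)
anyᵇ-∈ p {xs = y ∷ _}  (here refl) px = Equivalence.from T-∨ (inj₁ px)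
anyᵇ-∈ p {xs = y ∷ xs} (there x∈)  px = Equivalence.from (T-∨ {p y}) (inj₂ (anyᵇ-∈ p x∈ px))

-- Subsets of the cube

countᵇ-cube-suc : ∀ {n} (p : Vec Bool (suc n) → Bool) →
  countᵇ p (cube (suc n)) ≡ countᵇ (p ∘ (false ∷_)) (cube n) + countᵇ (p ∘ (true ∷_)) (cube n)
countᵇ-cube-suc {n} p = trans (countᵇ-++ p (map (false ∷_) (cube n)) _)
  (cong₂ _+_ (countᵇ-map p (false ∷_) (cube n)) (countᵇ-map p (true ∷_) (cube n)))

size-pair : ∀ {n} (S₀ S₁ : BFun n) → size {suc n} (S₀ , S₁) ≡ size S₀ + size S₁
size-pair S₀ S₁ = countᵇ-cube-suc (app (S₀ , S₁))

agreements disagreements : ∀ {n} → BFun n → (Vec Bool n → Bool) → (Vec Bool n → Bool) → ℕ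
agreements    {n} S g f = countᵇ (λ y → app S y ∧ eqB (g y) (f y)) (cube n)
disagreements {n} S g f = countᵇ (λ y → app S y ∧ not (eqB (g y) (f y))) (cube n)

agreements+disagreements : ∀ {n} (S : BFun n) g f → agreements S g f + disagreements S g f ≡ size S
agreements+disagreements {n} S g f = countᵇ-∧-not (app S) (λ y → eqB (g y) (f y)) (cube n)

disagreements-cong : ∀ {n} (S : BFun n) {g g′ f f′} →
  (∀ y → T (app S y) → g y ≡ g′ y) → (∀ y → T (app S y) → f y ≡ f′ y) →
  disagreements S g f ≡ disagreements S g′ f′
disagreements-cong {n} S {g} {g′} {f} {f′} g≗g′ f≗f′ = countᵇ-cong (cube n) pointwise
  where
  pointwise : ∀ y → (app S y ∧ not (eqB (g y) (f y))) ≡ (app S y ∧ not (eqB (g′ y) (f′ y)))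
  pointwise y with app S y in Sy
  ... | false = refl
  ... | true  = cong₂ (λ a b → not (eqB a b)) (g≗g′ y (subst T (sym Sy) _)) (f≗f′ y (subst T (sym Sy) _))

_⊆_ : ∀ {n} → BFun n → BFun n → Set
_⊆_ {n} γ S = ∀ (x : Vec Bool n) → app γ x ≡ true → app S x ≡ true

subsets : ∀ {n} → BFun n → List (BFun n)
subsets {zero}  false     = false ∷ []
subsets {zero}  true      = false ∷ true ∷ []
subsets {suc n} (S₀ , S₁) = dependentProduct (subsets S₀) (λ _ → subsets S₁)

subsets-⊆ : ∀ {n} (S : BFun n) → All (_⊆ S) (subsets S)
subsets-⊆ {zero}  false     = (λ { [] () }) ∷ []
subsets-⊆ {zero}  true      = (λ { [] _ → refl }) ∷ (λ { [] _ → refl }) ∷ []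
subsets-⊆ {suc n} (S₀ , S₁) = all-dependentProduct (subsets S₀)
  (All.map (λ γ₀⊆S₀ → All.map (λ γ₁⊆S₁ → λ { (false ∷ x) → γ₀⊆S₀ x ; (true ∷ x) → γ₁⊆S₁ x })
                               (subsets-⊆ S₁))
           (subsets-⊆ S₀))

subsets-complete : ∀ {n} (S γ : BFun n) → γ ⊆ S → γ ∈ subsets S
subsets-complete {zero}  false false _ = here refl
subsets-complete {zero}  false true  γ⊆S with γ⊆S [] refl
... | ()
subsets-complete {zero}  true  false _ = here refl
subsets-complete {zero}  true  true  _ = there (here refl)
subsets-complete {suc n} (S₀ , S₁) (γ₀ , γ₁) γ⊆S = ∈-dependentProduct⁺
  (subsets-complete S₀ γ₀ (γ⊆S ∘ (false ∷_))) (subsets-complete S₁ γ₁ (γ⊆S ∘ (true ∷_)))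

unique-subsets : ∀ {n} (S : BFun n) → Unique (subsets S)
unique-subsets {zero}  false     = [] ∷ []
unique-subsets {zero}  true      = ((λ ()) ∷ []) ∷ [] ∷ []
unique-subsets {suc n} (S₀ , S₁) = unique-dependentProduct (unique-subsets S₀) (λ _ → unique-subsets S₁)

sum-pow-agreements : ∀ {n} x (S : BFun n) (f : Vec Bool n → Bool) →
  sum (map (λ γ → x ^ agreements S (app γ) f) (subsets S)) ≡ suc x ^ size S
sum-pow-agreements {zero}  x false f = refl
sum-pow-agreements {zero}  x true  f with f []
... | true  = cong suc (+-identityʳ (x * 1))
... | false = +-comm (x * 1) 1
sum-pow-agreements {suc n} x (S₀ , S₁) f = begin
  sum (map w (dependentProduct (subsets S₀) (λ _ → subsets S₁)))
    ≡⟨ cong sum (map-cong split (dependentProduct (subsets S₀) (λ _ → subsets S₁))) ⟩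
  sum (map (λ γ → w₀ (proj₁ γ) * w₁ (proj₂ γ)) (dependentProduct (subsets S₀) (λ _ → subsets S₁)))
    ≡⟨ sum-dependentProduct w₀ w₁ (subsets S₀) (subsets S₁) ⟩
  sum (map w₀ (subsets S₀)) * sum (map w₁ (subsets S₁))
    ≡⟨ cong₂ _*_ (sum-pow-agreements x S₀ f₀) (sum-pow-agreements x S₁ f₁) ⟩
  suc x ^ size S₀ * suc x ^ size S₁
    ≡⟨ ^-distribˡ-+-* (suc x) (size S₀) (size S₁) ⟨
  suc x ^ (size S₀ + size S₁)
    ≡⟨ cong (suc x ^_) (size-pair S₀ S₁) ⟨
  suc x ^ size {suc n} (S₀ , S₁) ∎
  where
  open ≡-Reasoning
  f₀ f₁ : Vec Bool n → Bool
  f₀ = f ∘ (false ∷_)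
  f₁ = f ∘ (true ∷_)
  w : BFun (suc n) → ℕ
  w γ = x ^ agreements (S₀ , S₁) (app γ) f
  w₀ w₁ : BFun n → ℕ
  w₀ γ₀ = x ^ agreements S₀ (app γ₀) f₀
  w₁ γ₁ = x ^ agreements S₁ (app γ₁) f₁
  split : ∀ (γ : BFun n × BFun n) → w γ ≡ w₀ (proj₁ γ) * w₁ (proj₂ γ)
  split (γ₀ , γ₁) = trans
    (cong (x ^_) (countᵇ-cube-suc {n} (λ y → app (S₀ , S₁) y ∧ eqB (app (γ₀ , γ₁) y) (f y))))
    (^-distribˡ-+-* x (agreements S₀ (app γ₀) f₀) (agreements S₁ (app γ₁) f₁))

length-subsets : ∀ {n} (S : BFun n) → length (subsets S) ≡ 2 ^ size S
length-subsets S = begin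
  length (subsets S)                        ≡⟨ sum-map-1 (subsets S) ⟨
  sum (map (λ _ → 1) (subsets S))           ≡⟨ cong sum (map-cong (λ γ → ^-zeroˡ (agr γ)) (subsets S)) ⟨
  sum (map (λ γ → 1 ^ agr γ) (subsets S))   ≡⟨ sum-pow-agreements 1 S (λ _ → true) ⟩
  2 ^ size S                                ∎
  where
  open ≡-Reasoning
  agr : BFun _ → ℕ
  agr γ = agreements S (app γ) (λ _ → true)
  sum-map-1 : ∀ (xs : List A) → sum (map (λ _ → 1) xs) ≡ length xs
  sum-map-1 []       = refl
  sum-map-1 (_ ∷ xs) = cong suc (sum-map-1 xs)

full : (k : ℕ) → BFun k
full zero    = true
full (suc k) = full k , full k

app-full : ∀ {k} (x : Vec Bool k) → app (full k) x ≡ true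
app-full []          = refl
app-full (false ∷ x) = app-full x
app-full (true ∷ x)  = app-full x

size-full : ∀ k → size (full k) ≡ 2 ^ k
size-full zero    = refl
size-full (suc k) = begin
  size {suc k} (full k , full k) ≡⟨ size-pair (full k) (full k) ⟩
  size (full k) + size (full k)  ≡⟨ cong₂ _+_ (size-full k) (trans (size-full k) (sym (+-identityʳ (2 ^ k)))) ⟩
  2 ^ suc k                      ∎
  where open ≡-Reasoning

allBFun : (k : ℕ) → List (BFun k)
allBFun k = subsets (full k)

allBFun-complete : ∀ {k} (T : BFun k) → T ∈ allBFun k
allBFun-complete {k} T = subsets-complete (full k) T (λ x _ → app-full x)

length-allBFun : ∀ k → length (allBFun k) ≡ 2 ^ 2 ^ k
length-allBFun k = trans (length-subsets (full k)) (cong (2 ^_) (size-full k))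

-- Vectors of a given weight

ofWeight : (n r : ℕ) → List (Vec Bool n)
ofWeight zero    zero    = [] ∷ []
ofWeight zero    (suc r) = []
ofWeight (suc n) zero    = map (false ∷_) (ofWeight n zero)
ofWeight (suc n) (suc r) = map (true ∷_) (ofWeight n r) ++ map (false ∷_) (ofWeight n (suc r))

ofWeight-weight : ∀ n r → All (λ v → weight v ≡ r) (ofWeight n r)
ofWeight-weight zero    zero    = refl ∷ []
ofWeight-weight zero    (suc r) = []
ofWeight-weight (suc n) zero    = All.map⁺ (ofWeight-weight n zero)
ofWeight-weight (suc n) (suc r) =
  All.++⁺ (All.map⁺ (All.map (cong suc) (ofWeight-weight n r))) (All.map⁺ (ofWeight-weight n (suc r)))

unique-ofWeight : ∀ n r → Unique (ofWeight n r)
unique-ofWeight zero    zero    = [] ∷ []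
unique-ofWeight zero    (suc r) = []
unique-ofWeight (suc n) zero    = Unique.map⁺ ∷-injectiveʳ (unique-ofWeight n zero)
unique-ofWeight (suc n) (suc r) = Unique.++⁺ (Unique.map⁺ ∷-injectiveʳ (unique-ofWeight n r))
  (Unique.map⁺ ∷-injectiveʳ (unique-ofWeight n (suc r))) disjoint
  where
  disjoint : ∀ {v} → v ∈ map (true ∷_) (ofWeight n r) × v ∈ map (false ∷_) (ofWeight n (suc r)) → ⊥
  disjoint (v∈₁ , v∈₂) with ∈-map⁻ (true ∷_) v∈₁ | ∈-map⁻ (false ∷_) v∈₂
  ... | _ , _ , refl | _ , _ , ()

length-ofWeight : ∀ n r → length (ofWeight n r) ≡ n C r
length-ofWeight zero    zero    = refl
length-ofWeight zero    (suc r) = refl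
length-ofWeight (suc n) zero    = trans (length-map (false ∷_) (ofWeight n zero)) (length-ofWeight n zero)
length-ofWeight (suc n) (suc r) = begin
  length (map (true ∷_) (ofWeight n r) ++ map (false ∷_) (ofWeight n (suc r)))
    ≡⟨ length-map-++-map (true ∷_) (false ∷_) (ofWeight n r) _ ⟩
  length (ofWeight n r) + length (ofWeight n (suc r))
    ≡⟨ cong₂ _+_ (length-ofWeight n r) (length-ofWeight n (suc r)) ⟩
  n C r + n C suc r
    ≡⟨ nCk+nC[k+1]≡[n+1]C[k+1] n r ⟩
  suc n C suc r ∎
  where open ≡-Reasoning

weightAtMost : (n k : ℕ) → List (Vec Bool n)
weightAtMost zero    k       = [] ∷ []
weightAtMost (suc n) zero    = map (false ∷_) (weightAtMost n zero)
weightAtMost (suc n) (suc k) = map (true ∷_) (weightAtMost n k) ++ map (false ∷_) (weightAtMost n (suc k))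

weightAtMost-complete : ∀ n k (K : Vec Bool n) → weight K ≤ k → K ∈ weightAtMost n k
weightAtMost-complete zero    k       []          _        = here refl
weightAtMost-complete (suc n) zero    (false ∷ K) w≤       =
  ∈-map⁺ (false ∷_) (weightAtMost-complete n zero K w≤)
weightAtMost-complete (suc n) (suc k) (true ∷ K)  (s≤s w≤) =
  ∈-++⁺ˡ (∈-map⁺ (true ∷_) (weightAtMost-complete n k K w≤))
weightAtMost-complete (suc n) (suc k) (false ∷ K) w≤       =
  ∈-++⁺ʳ (map (true ∷_) (weightAtMost n k)) (∈-map⁺ (false ∷_) (weightAtMost-complete n (suc k) K w≤))

length-weightAtMost : ∀ n k → length (weightAtMost n k) ≤ suc n ^ k
length-weightAtMost zero    k       = ≤-reflexive (sym (^-zeroˡ k))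
length-weightAtMost (suc n) zero    = ≤-trans (≤-reflexive (length-map (false ∷_) (weightAtMost n zero)))
                                              (length-weightAtMost n zero)
length-weightAtMost (suc n) (suc k) = begin
  length (map (true ∷_) (weightAtMost n k) ++ map (false ∷_) (weightAtMost n (suc k)))
    ≡⟨ length-map-++-map (true ∷_) (false ∷_) (weightAtMost n k) _ ⟩
  length (weightAtMost n k) + length (weightAtMost n (suc k))
    ≤⟨ +-mono-≤ (length-weightAtMost n k) (length-weightAtMost n (suc k)) ⟩
  suc n ^ k + suc n * suc n ^ k
    ≤⟨ +-mono-≤ (^-monoˡ-≤ k (n≤1+n (suc n))) (*-monoʳ-≤ (suc n) (^-monoˡ-≤ k (n≤1+n (suc n)))) ⟩
  suc (suc n) ^ suc k ∎
  where open ≤-Reasoning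

-- 2 ^ n, in a form that Vec.take and Vec.drop can split
leaves : ℕ → ℕ
leaves zero    = 1
leaves (suc n) = leaves n + leaves n

leaves≡2^ : ∀ n → leaves n ≡ 2 ^ n
leaves≡2^ zero    = refl
leaves≡2^ (suc n) = cong₂ _+_ (leaves≡2^ n) (trans (leaves≡2^ n) (sym (+-identityʳ (2 ^ n))))

fromVec : ∀ n → Vec Bool (leaves n) → BFun n
fromVec zero    (b ∷ []) = b
fromVec (suc n) v        = fromVec n (Vec.take (leaves n) v) , fromVec n (Vec.drop (leaves n) v)

fromVec-injective : ∀ n {u v : Vec Bool (leaves n)} → fromVec n u ≡ fromVec n v → u ≡ v
fromVec-injective zero    {a ∷ []} {b ∷ []} refl = refl
fromVec-injective (suc n) {u} {v} eq = begin
  u                                                 ≡⟨ take++drop≡id (leaves n) u ⟨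
  Vec.take (leaves n) u Vec.++ Vec.drop (leaves n) u
    ≡⟨ cong₂ Vec._++_ (fromVec-injective n (cong proj₁ eq)) (fromVec-injective n (cong proj₂ eq)) ⟩
  Vec.take (leaves n) v Vec.++ Vec.drop (leaves n) v ≡⟨ take++drop≡id (leaves n) v ⟩
  v                                                 ∎
  where open ≡-Reasoning

weight-++ : ∀ {m n} (u : Vec Bool m) (v : Vec Bool n) → weight (u Vec.++ v) ≡ weight u + weight v
weight-++ []          v = refl
weight-++ (true ∷ u)  v = cong suc (weight-++ u v)
weight-++ (false ∷ u) v = weight-++ u v

size-fromVec : ∀ n (v : Vec Bool (leaves n)) → size (fromVec n v) ≡ weight v
size-fromVec zero    (false ∷ []) = refl
size-fromVec zero    (true ∷ [])  = refl
size-fromVec (suc n) v = begin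
  size {suc n} (fromVec n v₀ , fromVec n v₁)   ≡⟨ size-pair (fromVec n v₀) (fromVec n v₁) ⟩
  size (fromVec n v₀) + size (fromVec n v₁)    ≡⟨ cong₂ _+_ (size-fromVec n v₀) (size-fromVec n v₁) ⟩
  weight v₀ + weight v₁                        ≡⟨ weight-++ v₀ v₁ ⟨
  weight (v₀ Vec.++ v₁)                        ≡⟨ cong weight (take++drop≡id (leaves n) v) ⟩
  weight v                                     ∎
  where
  open ≡-Reasoning
  v₀ = Vec.take (leaves n) v
  v₁ = Vec.drop (leaves n) v

subsetsOfSize : (n m : ℕ) → List (BFun n)
subsetsOfSize n m = map (fromVec n) (ofWeight (leaves n) m)

unique-subsetsOfSize : ∀ n m → Unique (subsetsOfSize n m)
unique-subsetsOfSize n m = Unique.map⁺ (fromVec-injective n) (unique-ofWeight (leaves n) m)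

subsetsOfSize-size : ∀ n m → All (λ S → size S ≡ m) (subsetsOfSize n m)
subsetsOfSize-size n m =
  All.map⁺ (All.map (λ {v} w≡m → trans (size-fromVec n v) w≡m) (ofWeight-weight (leaves n) m))

length-subsetsOfSize : ∀ n m → length (subsetsOfSize n m) ≡ 2 ^ n C m
length-subsetsOfSize n m = begin
  length (subsetsOfSize n m)     ≡⟨ length-map (fromVec n) (ofWeight (leaves n) m) ⟩
  length (ofWeight (leaves n) m) ≡⟨ length-ofWeight (leaves n) m ⟩
  leaves n C m                   ≡⟨ cong (_C m) (leaves≡2^ n) ⟩
  2 ^ n C m                      ∎
  where open ≡-Reasoning

-- Juntas

DependsOnly : ∀ {n} → Vec Bool n → (Vec Bool n → Bool) → Set
DependsOnly {n} K f =
  ∀ (x y : Vec Bool n) → (∀ (i : Fin n) → lookup K i ≡ true → lookup x i ≡ lookup y i) → f x ≡ f y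

junta : ∀ {n k} → Vec Bool n → BFun k → Vec Bool n → Bool
junta K T x = appL T (proj K x)

tabulateL : (k : ℕ) → (List Bool → Bool) → BFun k
tabulateL zero    g = g []
tabulateL (suc k) g = tabulateL k (g ∘ (false ∷_)) , tabulateL k (g ∘ (true ∷_))

app-tabulateL : ∀ k g (v : Vec Bool k) → app (tabulateL k g) v ≡ g (Vec.toList v)
app-tabulateL zero    g []          = refl
app-tabulateL (suc k) g (false ∷ v) = app-tabulateL k (g ∘ (false ∷_)) v
app-tabulateL (suc k) g (true ∷ v)  = app-tabulateL k (g ∘ (true ∷_)) v

-- appL pads a short argument with falses, hence the unknown extension r
appL-tabulateL : ∀ k g (z : List Bool) → length z ≤ k → ∃[ r ] appL (tabulateL k g) z ≡ g (z ++ r)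
appL-tabulateL zero    g []          _        = [] , refl
appL-tabulateL (suc k) g []          _        = _ , app-tabulateL k (g ∘ (false ∷_)) _
appL-tabulateL (suc k) g (false ∷ z) (s≤s z≤) = appL-tabulateL k (g ∘ (false ∷_)) z z≤
appL-tabulateL (suc k) g (true ∷ z)  (s≤s z≤) = appL-tabulateL k (g ∘ (true ∷_)) z z≤

embed : ∀ {n} → Vec Bool n → List Bool → Vec Bool n
embed []          _       = []
embed (true ∷ K)  []      = false ∷ embed K []
embed (true ∷ K)  (a ∷ z) = a ∷ embed K z
embed (false ∷ K) z       = false ∷ embed K z

embed-proj : ∀ {n} (K x : Vec Bool n) r (i : Fin n) →
  lookup K i ≡ true → lookup x i ≡ lookup (embed K (proj K x ++ r)) i
embed-proj (true ∷ K)  (a ∷ x) r zero    _  = refl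
embed-proj (true ∷ K)  (a ∷ x) r (suc i) Ki = embed-proj K x r i Ki
embed-proj (false ∷ K) (a ∷ x) r (suc i) Ki = embed-proj K x r i Ki

length-proj : ∀ {n} (K x : Vec Bool n) → length (proj K x) ≡ weight K
length-proj []          []      = refl
length-proj (true ∷ K)  (a ∷ x) = cong suc (length-proj K x)
length-proj (false ∷ K) (a ∷ x) = length-proj K x

junta-representation : ∀ {n k} {K : Vec Bool n} {f} → weight K ≤ k → DependsOnly K f →
  ∀ x → f x ≡ junta K (tabulateL k (f ∘ embed K)) x
junta-representation {k = k} {K} {f} wK≤k f-dep x
  with appL-tabulateL k (f ∘ embed K) (proj K x) (≤-trans (≤-reflexive (length-proj K x)) wK≤k)
... | r , tab≡ = trans (f-dep x _ (embed-proj K x r)) (sym tab≡)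

^-distribʳ-* : ∀ a b e → (a * b) ^ e ≡ a ^ e * b ^ e
^-distribʳ-* a b zero    = refl
^-distribʳ-* a b (suc e) =
  trans (cong (a * b *_) (^-distribʳ-* a b e)) ([m*n]*[o*p]≡[m*o]*[n*p] a b (a ^ e) (b ^ e))

[a^x]^y≡[a^y]^x : ∀ a x y → (a ^ x) ^ y ≡ (a ^ y) ^ x
[a^x]^y≡[a^y]^x a x y = trans (^-*-assoc a x y) (trans (cong (a ^_) (*-comm x y)) (sym (^-*-assoc a y x)))

-- ⌈2m/3⌉
twoThirds : ℕ → ℕ
twoThirds m = m ∸ m / 3

twoThirds-≤ : ∀ a b {m} → a + b ≡ m → 3 * b ≤ m → twoThirds m ≤ a
twoThirds-≤ a b {m} a+b≡m 3b≤m = begin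
  m ∸ m / 3     ≤⟨ ∸-monoʳ-≤ m b≤m/3 ⟩
  m ∸ b         ≡⟨ cong (_∸ b) (sym a+b≡m) ⟩
  a + b ∸ b     ≡⟨ m+n∸n≡m a b ⟩
  a             ∎
  where
  open ≤-Reasoning
  b≤m/3 : b ≤ m / 3
  b≤m/3 = ≤-trans (≤-reflexive (sym (m*n/n≡m b 3))) (/-monoˡ-≤ 3 (≤-trans (≤-reflexive (*-comm b 3)) 3b≤m))

twoThirds-≥ : ∀ m → 2 * m ≤ 3 * twoThirds m
twoThirds-≥ m = begin
  2 * m               ≡⟨ m+n∸m≡n m (2 * m) ⟨
  3 * m ∸ m           ≤⟨ ∸-monoʳ-≤ (3 * m) (≤-trans (≤-reflexive (*-comm 3 (m / 3))) (m/n*n≤m m 3)) ⟩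
  3 * m ∸ 3 * (m / 3) ≡⟨ *-distribˡ-∸ 3 m (m / 3) ⟨
  3 * (m ∸ m / 3)     ∎
  where open ≤-Reasoning

cube-root-bound : ∀ x m → x ^ 3 * 4 ^ m ≤ 32 ^ m → x ≤ 2 ^ m
cube-root-bound x m x³4ᵐ≤32ᵐ = ≮⇒≥ λ 2ᵐ<x → <⇒≱ (^-monoˡ-< 3 2ᵐ<x) (begin
  x ^ 3                  ≤⟨ *-cancelʳ-≤ (x ^ 3) (8 ^ m) (4 ^ m) {{m^n≢0 4 m}}
                              (≤-trans x³4ᵐ≤32ᵐ (≤-reflexive (^-distribʳ-* 8 4 m))) ⟩
  8 ^ m                  ≡⟨ [a^x]^y≡[a^y]^x 2 3 m ⟩
  (2 ^ m) ^ 3            ∎)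
  where open ≤-Reasoning

complement-bound : ∀ a b {N} d → a + b ≡ N → b * d ≤ N → N * (d ∸ 1) ≤ a * d
complement-bound a b {N} d a+b≡N bd≤N = begin
  N * (d ∸ 1)           ≡⟨ trans (*-distribˡ-∸ N d 1) (cong (N * d ∸_) (*-identityʳ N)) ⟩
  N * d ∸ N             ≤⟨ ∸-monoʳ-≤ (N * d) bd≤N ⟩
  N * d ∸ b * d         ≡⟨ cong (λ c → c * d ∸ b * d) a+b≡N ⟨
  (a + b) * d ∸ b * d   ≡⟨ cong (_∸ b * d) (*-distribʳ-+ d a b) ⟩
  a * d + b * d ∸ b * d ≡⟨ m+n∸n≡m (a * d) (b * d) ⟩
  a * d                 ∎
  where open ≤-Reasoning

-- Labellings far from every junta

closeᵇ : ∀ {n} → ℕ → BFun n → (Vec Bool n → Bool) → BFun n → Bool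
closeᵇ m S f γ = 3 * disagreements S (app γ) f <ᵇ m

farᵇ : (n k m : ℕ) → BFun n → BFun n → Bool
farᵇ n k m S γ = not (anyᵇ (λ K → anyᵇ (λ T → closeᵇ m S (junta K T) γ) (allBFun k)) (weightAtMost n k))

gNO-on-S : ∀ {n k} (J : Vec Bool n) (S : BFun n) (b : BFun k) (γ : BFun n) y →
  T (app S y) → gNO J S b γ y ≡ app γ y
gNO-on-S J S b γ y _ with app S y
... | true = refl

farᵇ⇒far : ∀ {n k m} (J : Vec Bool n) (S : BFun n) (b : BFun k) (γ : BFun n) →
  T (farᵇ n k m S γ) → FarFromJuntas n k m S (gNO J S b γ)
farᵇ⇒far {n} {k} {m} J S b γ far f (K , wK≤k , f-dep) with m ≤? 3 * disagreements S (gNO J S b γ) f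
... | yes m≤ = m≤
... | no  m≰ = ⊥-elim (subst T (Equivalence.to T-not-≡ far)
  (anyᵇ-∈ _ (weightAtMost-complete n k K wK≤k) (anyᵇ-∈ _ (allBFun-complete table) close)))
  where
  table : BFun k
  table = tabulateL k (f ∘ embed K)
  same-disagreements : disagreements S (gNO J S b γ) f ≡ disagreements S (app γ) (junta K table)
  same-disagreements = disagreements-cong S (gNO-on-S J S b γ) (λ y _ → junta-representation wK≤k f-dep y)
  close : T (closeᵇ m S (junta K table) γ)
  close = <⇒<ᵇ (subst (λ c → 3 * c < m) same-disagreements (≰⇒> m≰))

count-close≤ : ∀ {n m} (S : BFun n) f → size S ≡ m →
  countᵇ (closeᵇ m S f) (subsets S) * 2 ^ twoThirds m ≤ 3 ^ m
count-close≤ {n} {m} S f |S|≡m = begin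
  countᵇ (closeᵇ m S f) (subsets S) * 2 ^ twoThirds m
    ≤⟨ countᵇ-markov (λ γ → 2 ^ agreements S (app γ) f) (subsets S) many-agreements ⟩
  sum (map (λ γ → 2 ^ agreements S (app γ) f) (subsets S))
    ≡⟨ sum-pow-agreements 2 S f ⟩
  3 ^ size S
    ≡⟨ cong (3 ^_) |S|≡m ⟩
  3 ^ m ∎
  where
  open ≤-Reasoning
  many-agreements : ∀ γ → T (closeᵇ m S f γ) → 2 ^ twoThirds m ≤ 2 ^ agreements S (app γ) f
  many-agreements γ close = ^-monoʳ-≤ 2 (twoThirds-≤ _ (disagreements S (app γ) f)
    (trans (agreements+disagreements S (app γ) f) |S|≡m)
    (<⇒≤ (<ᵇ⇒< (3 * disagreements S (app γ) f) m close)))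

count-not-far≤ : ∀ {n k m} (S : BFun n) → size S ≡ m →
  countᵇ (not ∘ farᵇ n k m S) (subsets S) * 2 ^ twoThirds m
    ≤ length (weightAtMost n k) * (length (allBFun k) * 3 ^ m)
count-not-far≤ {n} {k} {m} S |S|≡m = begin
  countᵇ (not ∘ farᵇ n k m S) (subsets S) * 2 ^ twoThirds m
    ≡⟨ cong (_* 2 ^ twoThirds m) (countᵇ-cong (subsets S) (λ γ → not-involutive _)) ⟩
  countᵇ (λ γ → anyᵇ (λ K → closeᵇ-some-table K γ) (weightAtMost n k)) (subsets S) * 2 ^ twoThirds m
    ≤⟨ countᵇ-union-bound closeᵇ-some-table (weightAtMost n k) (subsets S) (λ K →
         countᵇ-union-bound (λ T → closeᵇ m S (junta K T)) (allBFun k) (subsets S) (λ T →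
           count-close≤ S (junta K T) |S|≡m)) ⟩
  length (weightAtMost n k) * (length (allBFun k) * 3 ^ m) ∎
  where
  open ≤-Reasoning
  closeᵇ-some-table : Vec Bool n → BFun n → Bool
  closeᵇ-some-table K γ = anyᵇ (λ T → closeᵇ m S (junta K T) γ) (allBFun k)

FewJuntas : (d n k m : ℕ) → Set
FewJuntas d n k m = (d * (length (weightAtMost n k) * (length (allBFun k) * 3 ^ m))) ^ 3 ≤ 32 ^ m

count-far≥ : ∀ {n k m} d (S : BFun n) → size S ≡ m → FewJuntas d n k m →
  2 ^ m * (d ∸ 1) ≤ countᵇ (farᵇ n k m S) (subsets S) * d
count-far≥ {n} {k} {m} d S |S|≡m few = complement-bound _ bad d far+notFar bad*d≤2ᵐ
  where
  open ≤-Reasoning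
  Y   = length (weightAtMost n k) * (length (allBFun k) * 3 ^ m)
  bad = countᵇ (not ∘ farᵇ n k m S) (subsets S)
  far+notFar : countᵇ (farᵇ n k m S) (subsets S) + bad ≡ 2 ^ m
  far+notFar = begin-equality
    countᵇ (farᵇ n k m S) (subsets S) + bad ≡⟨ countᵇ-∧-not (λ _ → true) (farᵇ n k m S) (subsets S) ⟩
    countᵇ (λ _ → true) (subsets S)         ≡⟨ countᵇ-true (subsets S) ⟩
    length (subsets S)                      ≡⟨ length-subsets S ⟩
    2 ^ size S                              ≡⟨ cong (2 ^_) |S|≡m ⟩
    2 ^ m                                   ∎
  4ᵐ≤ : 4 ^ m ≤ (2 ^ twoThirds m) ^ 3
  4ᵐ≤ = begin
    4 ^ m                  ≡⟨ ^-*-assoc 2 2 m ⟩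
    2 ^ (2 * m)            ≤⟨ ^-monoʳ-≤ 2 (≤-trans (twoThirds-≥ m) (≤-reflexive (*-comm 3 (twoThirds m)))) ⟩
    2 ^ (twoThirds m * 3)  ≡⟨ ^-*-assoc 2 (twoThirds m) 3 ⟨
    (2 ^ twoThirds m) ^ 3  ∎
  -- cubing clears the fractional exponent in count-not-far≤
  bad*d≤2ᵐ : bad * d ≤ 2 ^ m
  bad*d≤2ᵐ = cube-root-bound (bad * d) m (begin
    (bad * d) ^ 3 * 4 ^ m                  ≤⟨ *-monoʳ-≤ ((bad * d) ^ 3) 4ᵐ≤ ⟩
    (bad * d) ^ 3 * (2 ^ twoThirds m) ^ 3  ≡⟨ ^-distribʳ-* (bad * d) (2 ^ twoThirds m) 3 ⟨
    (bad * d * 2 ^ twoThirds m) ^ 3        ≡⟨ cong (_^ 3) (xy∙z≈y∙xz bad d (2 ^ twoThirds m)) ⟩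
    (d * (bad * 2 ^ twoThirds m)) ^ 3      ≤⟨ ^-monoˡ-≤ 3 (*-monoʳ-≤ d (count-not-far≤ S |S|≡m)) ⟩
    (d * Y) ^ 3                            ≤⟨ few ⟩
    32 ^ m                                 ∎)

farSubsets : (n k m : ℕ) → BFun n → List (BFun n)
farSubsets n k m S = filterᵇ (farᵇ n k m S) (subsets S)

goodOutcomes : (n k m : ℕ) → List (Outcome n k)
goodOutcomes n k m =
  dependentProduct (ofWeight n k)        λ _ →
  dependentProduct (subsetsOfSize n m)   λ S →
  dependentProduct (allBFun k)           λ _ →
  farSubsets n k m S

unique-goodOutcomes : ∀ n k m → Unique (goodOutcomes n k m)
unique-goodOutcomes n k m =
  unique-dependentProduct (unique-ofWeight n k)        λ _ →
  unique-dependentProduct (unique-subsetsOfSize n m)   λ S →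
  unique-dependentProduct (unique-subsets (full k))    λ _ →
  Unique.filter⁺ (T? ∘ farᵇ n k m S) (unique-subsets S)

goodOutcomes-good : ∀ n k m → All (Good n k m) (goodOutcomes n k m)
goodOutcomes-good n k m =
  all-dependentProduct (ofWeight n k) (All.map (λ {J} |J|≡k →
  all-dependentProduct (subsetsOfSize n m) (All.map (λ {S} |S|≡m →
  all-dependentProduct (allBFun k) (All.tabulate λ {b} _ → far-good J S b |J|≡k |S|≡m))
  (subsetsOfSize-size n m)))
  (ofWeight-weight n k))
  where
  far-good : ∀ J S b → weight J ≡ k → size S ≡ m → All (λ γ → Good n k m (J , S , b , γ)) (farSubsets n k m S)
  far-good J S b |J|≡k |S|≡m = All.zipWith (λ { {γ} (γ⊆S , far) → (|J|≡k , |S|≡m , γ⊆S) , farᵇ⇒far J S b γ far })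
    ( All.filter⁺ (T? ∘ farᵇ n k m S) (subsets-⊆ S)
    , All.all-filter (T? ∘ farᵇ n k m S) (subsets S))

length-goodOutcomes : ∀ n k m d → FewJuntas d n k m →
  total n k m * (d ∸ 1) ≤ length (goodOutcomes n k m) * d
length-goodOutcomes n k m d few = begin
  total n k m * (d ∸ 1)
    ≡⟨ reassociate (n C k) (2 ^ n C m) (2 ^ 2 ^ k) (2 ^ m) (d ∸ 1) ⟩
  (n C k) * ((2 ^ n C m) * (2 ^ 2 ^ k * (2 ^ m * (d ∸ 1))))
    ≡⟨ lengths ⟨
  length (ofWeight n k) * (length (subsetsOfSize n m) * (length (allBFun k) * (2 ^ m * (d ∸ 1))))
    ≤⟨ length-dependentProduct-≥ (ofWeight n k) (All.tabulate λ _ →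
         length-dependentProduct-≥ (subsetsOfSize n m) (All.map per-S (subsetsOfSize-size n m))) ⟩
  length (goodOutcomes n k m) * d ∎
  where
  open ≤-Reasoning
  reassociate : ∀ a b c e f → a * b * c * e * f ≡ a * (b * (c * (e * f)))
  reassociate = solve-∀
  lengths : length (ofWeight n k) * (length (subsetsOfSize n m) * (length (allBFun k) * (2 ^ m * (d ∸ 1))))
          ≡ (n C k) * ((2 ^ n C m) * (2 ^ 2 ^ k * (2 ^ m * (d ∸ 1))))
  lengths rewrite length-ofWeight n k | length-subsetsOfSize n m | length-allBFun k = refl
  per-S : ∀ {S} → size S ≡ m →
    length (allBFun k) * (2 ^ m * (d ∸ 1)) ≤ length (dependentProduct (allBFun k) λ _ → farSubsets n k m S) * d
  per-S {S} |S|≡m = length-dependentProduct-≥ (allBFun k) (All.tabulate λ _ →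
    ≤-trans (count-far≥ d S |S|≡m few) (≤-reflexive (cong (_* d) (sym (length-filterᵇ _ (subsets S))))))

-- Estimates from m ≥ 36 · 2^k ln n

ceilMulLn-positive : ∀ {t n m} → 2 ≤ n → IsCeilMulLn (suc t) n m → 1 ≤ m
ceilMulLn-positive {m = suc m} _ _ = s≤s z≤n
ceilMulLn-positive {t} {n} {zero} 2≤n (upper , _) = ⊥-elim (<⇒≱ 2≤n (*-cancelʳ-≤ n 1 c
  (≤-trans (upper 1 z<s) (≤-reflexive (sym (*-identityˡ c))))))
  where
  c = (1 * suc t) ^ 1

-- The first clause of IsCeilMulLn at N = m: n ≤ (c/(c-1))^m.
ceilMulLn-bound : ∀ {c n m} → 2 ≤ c → 2 ≤ n → IsCeilMulLn c n m → n * pred c ^ m ≤ c ^ m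
ceilMulLn-bound {suc t} {n} {m} (s≤s 1≤t) 2≤n ceil@(upper , _) with ceilMulLn-positive 2≤n ceil
... | 1≤m = *-cancelˡ-≤ (m ^ m) {{m^n≢0 m m {{>-nonZero 1≤m}}}} (begin
  m ^ m * (n * t ^ m)       ≡⟨ x∙yz≈y∙xz (m ^ m) n (t ^ m) ⟩
  n * (m ^ m * t ^ m)       ≡⟨ cong (n *_) (^-distribʳ-* m t m) ⟨
  n * (m * t) ^ m           ≡⟨ cong (λ x → n * x ^ m) m*t≡ ⟩
  n * (m * suc t ∸ m) ^ m   ≤⟨ upper m m<m*c ⟩
  (m * suc t) ^ m           ≡⟨ ^-distribʳ-* m (suc t) m ⟩
  m ^ m * suc t ^ m         ∎)
  where
  open ≤-Reasoning
  m*t≡ : m * t ≡ m * suc t ∸ m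
  m*t≡ = trans (*-distribˡ-∸ m (suc t) 1) (cong (m * suc t ∸_) (*-identityʳ m))
  m<m*c : m < m * suc t
  m<m*c = <-≤-trans (m<m+n m (*-mono-≤ 1≤m 1≤t)) (≤-reflexive (sym (*-suc m t)))

-- (1 - 1/(t+1))^E ≥ 1 - E/(t+1), cleared of denominators
bernoulli : ∀ t E r → E + r ≡ suc t → suc t ^ E * r ≤ suc t * t ^ E
bernoulli t zero    r r≡c = ≤-reflexive (trans (+-identityʳ r) (trans r≡c (sym (*-identityʳ (suc t)))))
bernoulli t (suc E) r E+r≡c = begin
  suc t * suc t ^ E * r     ≡⟨ xy∙z≈y∙xz (suc t) (suc t ^ E) r ⟩
  suc t ^ E * (suc t * r)   ≤⟨ *-monoʳ-≤ (suc t ^ E) c*r≤t*[r+1] ⟩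
  suc t ^ E * (t * suc r)   ≡⟨ x∙yz≈y∙xz (suc t ^ E) t (suc r) ⟩
  t * (suc t ^ E * suc r)   ≤⟨ *-monoʳ-≤ t (bernoulli t E (suc r) (trans (+-suc E r) E+r≡c)) ⟩
  t * (suc t * t ^ E)       ≡⟨ x∙yz≈y∙xz t (suc t) (t ^ E) ⟩
  suc t * (t * t ^ E)       ∎
  where
  open ≤-Reasoning
  r≤t : r ≤ t
  r≤t = s≤s⁻¹ (≤-trans (m≤n+m (suc r) E) (≤-reflexive (trans (+-suc E r) E+r≡c)))
  c*r≤t*[r+1] : suc t * r ≤ t * suc r
  c*r≤t*[r+1] = ≤-trans (+-monoˡ-≤ (t * r) r≤t) (≤-reflexive (sym (*-suc t r)))

*-≤-via-ratio : ∀ a b c x y .{{_ : NonZero x}} → a * y ≤ x → x * b ≤ c * y → a * b ≤ c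
*-≤-via-ratio a b c x y ay≤x xb≤cy = *-cancelʳ-≤ (a * b) c x (begin
  a * b * x     ≡⟨ *-assoc a b x ⟩
  a * (b * x)   ≡⟨ cong (a *_) (*-comm b x) ⟩
  a * (x * b)   ≤⟨ *-monoʳ-≤ a xb≤cy ⟩
  a * (c * y)   ≡⟨ x∙yz≈y∙xz a c y ⟩
  c * (a * y)   ≤⟨ *-monoʳ-≤ c ay≤x ⟩
  c * x         ∎)
  where open ≤-Reasoning

-- n ≤ (c/(c-1))^m and, by Bernoulli, (c/(c-1))^E ≤ c/(c-E) = 18/17 for c = 18E.
n^E*17^m≤18^m : ∀ {n m} E .{{_ : NonZero E}} → n * pred (18 * E) ^ m ≤ (18 * E) ^ m → n ^ E * 17 ^ m ≤ 18 ^ m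
n^E*17^m≤18^m {n} {m} E@(suc _) n*tᵐ≤cᵐ = *-cancelʳ-≤ (n ^ E * 17 ^ m) (18 ^ m) (E ^ m) {{m^n≢0 E m}} (begin
  n ^ E * 17 ^ m * E ^ m   ≡⟨ *-assoc (n ^ E) (17 ^ m) (E ^ m) ⟩
  n ^ E * (17 ^ m * E ^ m) ≡⟨ cong (n ^ E *_) (^-distribʳ-* 17 E m) ⟨
  n ^ E * (17 * E) ^ m     ≤⟨ *-≤-via-ratio (n ^ E) ((17 * E) ^ m) (c ^ m) ((c ^ m) ^ E) ((t ^ m) ^ E)
                                {{m^n≢0 (c ^ m) E {{m^n≢0 c m}}}} nᴱ-bound bernoulli-bound ⟩
  (18 * E) ^ m             ≡⟨ ^-distribʳ-* 18 E m ⟩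
  18 ^ m * E ^ m           ∎)
  where
  open ≤-Reasoning
  c = 18 * E
  t = pred c
  nᴱ-bound : n ^ E * (t ^ m) ^ E ≤ (c ^ m) ^ E
  nᴱ-bound = ≤-trans (≤-reflexive (sym (^-distribʳ-* n (t ^ m) E))) (^-monoˡ-≤ E n*tᵐ≤cᵐ)
  bernoulli-bound : (c ^ m) ^ E * (17 * E) ^ m ≤ c ^ m * (t ^ m) ^ E
  bernoulli-bound = begin
    (c ^ m) ^ E * (17 * E) ^ m   ≡⟨ cong (_* (17 * E) ^ m) ([a^x]^y≡[a^y]^x c m E) ⟩
    (c ^ E) ^ m * (17 * E) ^ m   ≡⟨ ^-distribʳ-* (c ^ E) (17 * E) m ⟨
    (c ^ E * (17 * E)) ^ m       ≤⟨ ^-monoˡ-≤ m (bernoulli t E (17 * E) refl) ⟩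
    (c * t ^ E) ^ m              ≡⟨ ^-distribʳ-* c (t ^ E) m ⟩
    c ^ m * (t ^ E) ^ m          ≡⟨ cong (c ^ m *_) ([a^x]^y≡[a^y]^x t E m) ⟩
    c ^ m * (t ^ m) ^ E          ∎

n<2^n : ∀ n → n < 2 ^ n
n<2^n zero    = s≤s z≤n
n<2^n (suc n) = begin-strict
  suc n           ≡⟨ +-comm 1 n ⟩
  n + 1           <⟨ +-monoˡ-< 1 (n<2^n n) ⟩
  2 ^ n + 1       ≤⟨ +-monoʳ-≤ (2 ^ n) (≤-trans (m^n>0 2 n) (≤-reflexive (sym (+-identityʳ (2 ^ n))))) ⟩
  2 ^ suc n       ∎
  where open ≤-Reasoning

linear≤2^ : ∀ D {k} → D + 6 ≤′ k → D + 6 * k ≤ 2 ^ k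
linear≤2^ D (≤′-reflexive refl) = begin
  D + 6 * (D + 6)                  ≤⟨ m≤m+n _ (57 * D + 28) ⟩
  D + 6 * (D + 6) + (57 * D + 28)  ≡⟨ expand D ⟩
  suc D * 64                       ≤⟨ *-monoˡ-≤ 64 (n<2^n D) ⟩
  2 ^ D * 64                       ≡⟨ ^-distribˡ-+-* 2 D 6 ⟨
  2 ^ (D + 6)                      ∎
  where
  open ≤-Reasoning
  expand : ∀ D → D + 6 * (D + 6) + (57 * D + 28) ≡ suc D * 64
  expand = solve-∀
linear≤2^ D {suc k} (≤′-step D+6≤′k) = begin
  D + 6 * suc k                ≡⟨ expand D k ⟩
  D + 6 * k + 6                ≤⟨ +-monoʳ-≤ (D + 6 * k) 6≤6k ⟩
  D + 6 * k + 6 * k            ≤⟨ +-monoʳ-≤ (D + 6 * k) (m≤n+m (6 * k) D) ⟩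
  (D + 6 * k) + (D + 6 * k)    ≤⟨ +-mono-≤ IH (≤-trans IH (≤-reflexive (sym (+-identityʳ (2 ^ k))))) ⟩
  2 ^ suc k                    ∎
  where
  open ≤-Reasoning
  IH = linear≤2^ D D+6≤′k
  6≤6k : 6 ≤ 6 * k
  6≤6k = ≤-trans (≤-trans (m≤n+m 6 D) (≤′⇒≤ D+6≤′k)) (m≤n*m k 6)
  expand : ∀ D k → D + 6 * suc k ≡ D + 6 * k + 6
  expand = solve-∀

juntas≤n^ : ∀ d n k → 8 ≤ n → d ^ 3 + 6 ≤ k → (d * (suc n ^ k * 2 ^ 2 ^ k)) ^ 3 ≤ n ^ (2 * 2 ^ k)
juntas≤n^ d n k 8≤n K≤k = begin
  (d * (suc n ^ k * 2 ^ P)) ^ 3                 ≡⟨ ^-distribʳ-* d _ 3 ⟩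
  d ^ 3 * (suc n ^ k * 2 ^ P) ^ 3               ≡⟨ cong (d ^ 3 *_) (^-distribʳ-* (suc n ^ k) (2 ^ P) 3) ⟩
  d ^ 3 * ((suc n ^ k) ^ 3 * (2 ^ P) ^ 3)       ≤⟨ *-mono-≤ d³≤ (*-mono-≤ [n+1]ᵏ³≤ 2ᴾ³≤) ⟩
  n ^ D * (n ^ (6 * k) * n ^ P)                 ≡⟨ cong (n ^ D *_) (^-distribˡ-+-* n (6 * k) P) ⟨
  n ^ D * n ^ (6 * k + P)                       ≡⟨ ^-distribˡ-+-* n D (6 * k + P) ⟨
  n ^ (D + (6 * k + P))                         ≡⟨ cong (n ^_) (+-assoc D (6 * k) P) ⟨
  n ^ (D + 6 * k + P)                           ≤⟨ ^-monoʳ-≤ n {{n≢0}} (+-monoˡ-≤ P exponents) ⟩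
  n ^ (P + P)                                   ≡⟨ cong (λ e → n ^ (P + e)) (+-identityʳ P) ⟨
  n ^ (2 * P)                                   ∎
  where
  open ≤-Reasoning
  P = 2 ^ k
  D = d ^ 3
  2≤n : 2 ≤ n
  2≤n = ≤-trans (s≤s (s≤s z≤n)) 8≤n
  n≢0 : NonZero n
  n≢0 = >-nonZero (≤-trans (s≤s z≤n) 2≤n)
  exponents : D + 6 * k ≤ P
  exponents = linear≤2^ D (≤⇒≤′ K≤k)
  d³≤ : d ^ 3 ≤ n ^ D
  d³≤ = ≤-trans (<⇒≤ (n<2^n D)) (^-monoˡ-≤ D 2≤n)
  [n+1]ᵏ³≤ : (suc n ^ k) ^ 3 ≤ n ^ (6 * k)
  [n+1]ᵏ³≤ = begin
    (suc n ^ k) ^ 3        ≤⟨ ^-monoˡ-≤ 3 (^-monoˡ-≤ k n+1≤n²) ⟩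
    ((n ^ 2) ^ k) ^ 3      ≡⟨ trans (cong (_^ 3) (^-*-assoc n 2 k)) (^-*-assoc n (2 * k) 3) ⟩
    n ^ (2 * k * 3)        ≡⟨ cong (n ^_) (six k) ⟩
    n ^ (6 * k)            ∎
    where
    n+1≤n² : suc n ≤ n ^ 2
    n+1≤n² = begin
      suc n      ≤⟨ +-monoˡ-≤ n (≤-trans (s≤s z≤n) 2≤n) ⟩
      n + n      ≡⟨ cong (n +_) (+-identityʳ n) ⟨
      2 * n      ≤⟨ *-monoˡ-≤ n 2≤n ⟩
      n * n      ≡⟨ cong (n *_) (*-identityʳ n) ⟨
      n ^ 2      ∎
    six : ∀ k → 2 * k * 3 ≡ 6 * k
    six = solve-∀
  2ᴾ³≤ : (2 ^ P) ^ 3 ≤ n ^ P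
  2ᴾ³≤ = begin
    (2 ^ P) ^ 3      ≡⟨ [a^x]^y≡[a^y]^x 2 P 3 ⟩
    8 ^ P            ≤⟨ ^-monoˡ-≤ P 8≤n ⟩
    n ^ P            ∎

cube-≤-32^ : ∀ x N m → x ^ 3 ≤ N → N * 17 ^ m ≤ 18 ^ m → (x * 3 ^ m) ^ 3 ≤ 32 ^ m
cube-≤-32^ x N m x³≤N N*17ᵐ≤18ᵐ = begin
  (x * 3 ^ m) ^ 3      ≡⟨ ^-distribʳ-* x (3 ^ m) 3 ⟩
  x ^ 3 * (3 ^ m) ^ 3  ≡⟨ cong (x ^ 3 *_) ([a^x]^y≡[a^y]^x 3 m 3) ⟩
  x ^ 3 * 27 ^ m       ≤⟨ *-monoˡ-≤ (27 ^ m) x³≤N ⟩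
  N * 27 ^ m           ≤⟨ *-cancelʳ-≤ (N * 27 ^ m) (32 ^ m) (17 ^ m) {{m^n≢0 17 m}} (begin
    N * 27 ^ m * 17 ^ m  ≡⟨ xy∙z≈xz∙y N (27 ^ m) (17 ^ m) ⟩
    N * 17 ^ m * 27 ^ m  ≤⟨ *-monoˡ-≤ (27 ^ m) N*17ᵐ≤18ᵐ ⟩
    18 ^ m * 27 ^ m      ≡⟨ ^-distribʳ-* 18 27 m ⟨
    486 ^ m              ≤⟨ ^-monoˡ-≤ m (≤ᵇ⇒≤ 486 544 _) ⟩
    544 ^ m              ≡⟨ ^-distribʳ-* 32 17 m ⟩
    32 ^ m * 17 ^ m      ∎) ⟩
  32 ^ m               ∎
  where open ≤-Reasoning

few-juntas : ∀ d k n m → d ^ 3 + 6 ≤ k → 8 ≤ n → IsCeilMulLn (36 * 2 ^ k) n m → FewJuntas d n k m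
few-juntas d k n m K≤k 8≤n ceil = begin
  (d * (length (weightAtMost n k) * (length (allBFun k) * 3 ^ m))) ^ 3
    ≤⟨ ^-monoˡ-≤ 3 (*-monoʳ-≤ d (*-mono-≤ (length-weightAtMost n k) #tables)) ⟩
  (d * (suc n ^ k * (2 ^ 2 ^ k * 3 ^ m))) ^ 3
    ≡⟨ cong (λ x → (d * x) ^ 3) (*-assoc (suc n ^ k) (2 ^ 2 ^ k) (3 ^ m)) ⟨
  (d * (suc n ^ k * 2 ^ 2 ^ k * 3 ^ m)) ^ 3
    ≡⟨ cong (_^ 3) (*-assoc d (suc n ^ k * 2 ^ 2 ^ k) (3 ^ m)) ⟨
  (d * (suc n ^ k * 2 ^ 2 ^ k) * 3 ^ m) ^ 3
    ≤⟨ cube-≤-32^ (d * (suc n ^ k * 2 ^ 2 ^ k)) _ m (juntas≤n^ d n k 8≤n K≤k) n^[2·2ᵏ]*17^m≤18^m ⟩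
  32 ^ m ∎
  where
  open ≤-Reasoning
  #tables : length (allBFun k) * 3 ^ m ≤ 2 ^ 2 ^ k * 3 ^ m
  #tables = ≤-reflexive (cong (_* 3 ^ m) (length-allBFun k))
  2≤n : 2 ≤ n
  2≤n = ≤-trans (s≤s (s≤s z≤n)) 8≤n
  n^[2·2ᵏ]*17^m≤18^m : n ^ (2 * 2 ^ k) * 17 ^ m ≤ 18 ^ m
  n^[2·2ᵏ]*17^m≤18^m = n^E*17^m≤18^m {n} {m} (2 * 2 ^ k) {{m*n≢0 2 (2 ^ k) {{_}} {{m^n≢0 2 k}}}}
    (subst (λ c → n * pred c ^ m ≤ c ^ m) (*-assoc 18 2 (2 ^ k))
      (ceilMulLn-bound (≤-trans (s≤s (s≤s z≤n)) (m≤m*n 36 (2 ^ k) {{m^n≢0 2 k}})) 2≤n ceil))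

lemma12 : (d : ℕ) → 1 ≤ d → ∃[ K ] ((k n m : ℕ) → K ≤ k → 1 ≤ k → 200 * k ≤ n →
              IsCeilMulLn (36 * 2 ^ k) n m →
              ∃[ L ] (Unique {A = Outcome n k} L × All (Good n k m) L ×
                      total n k m * (d ∸ 1) ≤ length L * d))
lemma12 d _ = d ^ 3 + 6 , good-outcomes
  where
  good-outcomes : (k n m : ℕ) → d ^ 3 + 6 ≤ k → 1 ≤ k → 200 * k ≤ n → IsCeilMulLn (36 * 2 ^ k) n m →
    ∃[ L ] (Unique {A = Outcome n k} L × All (Good n k m) L × total n k m * (d ∸ 1) ≤ length L * d)
  good-outcomes k n m K≤k 1≤k 200k≤n ceil =
    goodOutcomes n k m , unique-goodOutcomes n k m , goodOutcomes-good n k m ,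
    length-goodOutcomes n k m d (few-juntas d k n m K≤k 8≤n ceil)
    where
    8≤n : 8 ≤ n
    8≤n = ≤-trans (≤ᵇ⇒≤ 8 200 _) (≤-trans (*-monoʳ-≤ 200 1≤k) 200k≤n)
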